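{- Let $X$ and $Y$ be finite nonempty sets and let $F: X \to 2^Y$ be a set-valued mapping. The following are equivalent: (i) $F$ is alldifferent; (ii) $F$ admits an alldifferent selection and $F(W) \cap F(X\setminus W) = \emptyset$ for every critical set $W \subset X$ of $F$; (iii) there exists a Hall partition $(W_1,\ldots,W_m)$ of $F$ such that $F^p = F$.
   Context: A set-valued mapping $F: X \to 2^Y$ assigns to each $x$ a (possibly empty) subset $F(x) \subset Y$; $F(W) = \bigcup_{x\in W}F(x)$; $\sharp$ is cardinality. A selection of $F$ is $s: X\to Y$ with $s(x)\in F(x)$ for all $x$; alldifferent means injective. The alldifferent kernel is $F^*(x) = \{y\in F(x): \exists$ alldifferent selection $s$ of $F$ with $s(x)=y\}$. $F$ is called alldifferent if $F(x)\ne\emptyset$ for all $x$ and $F^*=F$. For $W \subset X$, $F_W: X\setminus W \to 2^Y$ is $F_W(x) = F(x) \setminus F(W)$. For set-valued $G$ on a finite set, a subset $W$ of its domain is critical for $G$ if $W\ne\emptyset$ and $\sharp G(W)=\sharp W$; non-reducible for $G$ if $W\ne\emptyset$ and no proper subset of $W$ is critical for $G$. A tuple $(W_1,\ldots,W_m)$, $m\ge1$, is a Hall partition of $F$ if the $W_i$ are nonempty, pairwise disjoint with union $X$, and with $G_i = F_{W_1\cup\cdots\cup W_{i-1}}$ ($G_1=F$): (i) $G_i(x)\neq\emptyset$ for $x \in W_i$; (ii) $W_i$ is non-reducible for $G_i$; (iii) $W_i$ is critical for $G_i$ for $i \le m-1$. Given a Hall partition, $F^p(x) = G_i(x)$ for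 $x\in W_i$. -}

module Defs where

open import Data.Nat using (ℕ; suc; _<_; _<ᵇ_)
open import Data.Fin using (Fin; toℕ)
open import Data.Fin.Subset using (Subset; _∈_; _⊂_; _∩_; _─_; ⋃; ∁; ∣_∣; Nonempty; Empty)
  renaming (⊥ to ∅)
open import Data.Bool using (if_then_else_)
open import Data.Vec using (lookup)
open import Data.List using (List; map; allFin)
open import Data.Product using (Σ; ∃; _×_)
open import Function.Definitions using (Injective)
open import Relation.Binary.PropositionalEquality using (_≡_; _≢_)
open import Relation.Nullary using (¬_)

SetMap : ℕ → ℕ → Set
SetMap n k = Fin n → Subset k

module _ {n k : ℕ} where

  img : SetMap n k → Subset n → Subset k
  img F W = ⋃ (map (λ x → if lookup W x then F x else ∅) (allFin n))

  IsSelection : SetMap n k → (Fin n → Fin k) → Set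
  IsSelection F s = ∀ x → s x ∈ F x

  IsAllDiffSelection : SetMap n k → (Fin n → Fin k) → Set
  IsAllDiffSelection F s = IsSelection F s × Injective _≡_ _≡_ s

  HasAllDiffSelection : SetMap n k → Set
  HasAllDiffSelection F = ∃ λ s → IsAllDiffSelection F s

  _∈Kernel_at_ : Fin k → SetMap n k → Fin n → Set
  y ∈Kernel F at x = y ∈ F x × ∃ λ s → IsAllDiffSelection F s × s x ≡ y

  IsAllDifferent : SetMap n k → Set
  IsAllDifferent F =
    (∀ x → Nonempty (F x)) ×
    (∀ x y → (y ∈Kernel F at x → y ∈ F x) × (y ∈ F x → y ∈Kernel F at x))

  -- F_W(x) = F(x) \ F(W)   (defined on all of X; only used on X \ W)
  restrict : SetMap n k → Subset n → SetMap n k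
  restrict F W x = F x ─ img F W

  Critical : SetMap n k → Subset n → Set
  Critical G W = Nonempty W × ∣ img G W ∣ ≡ ∣ W ∣

  NonReducible : SetMap n k → Subset n → Set
  NonReducible G W = Nonempty W × (∀ V → V ⊂ W → ¬ Critical G V)

  Cond2 : SetMap n k → Set
  Cond2 F = HasAllDiffSelection F ×
            (∀ W → Critical F W → Empty (img F W ∩ img F (∁ W)))

  prefixUnion : {m : ℕ} → (Fin m → Subset n) → Fin m → Subset n
  prefixUnion {m} W i =
    ⋃ (map (λ j → if toℕ j <ᵇ toℕ i then W j else ∅) (allFin m))

  -- Hall partition (W_0, …, W_m) with m+1 ≥ 1 blocks (0-indexed)
  record HallPartition (F : SetMap n k) : Set where
    field
      m      : ℕ
      W      : Fin (suc m) → Subset n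
    G : Fin (suc m) → SetMap n k
    G i = restrict F (prefixUnion W i)
    field
      nonempty : ∀ i → Nonempty (W i)
      disjoint : ∀ i j → i ≢ j → Empty (W i ∩ W j)
      covers   : ∀ x → ∃ λ i → x ∈ W i
      cond-i   : ∀ i x → x ∈ W i → Nonempty (G i x)
      cond-ii  : ∀ i → NonReducible (G i) (W i)
      cond-iii : ∀ i → toℕ i < m → Critical (G i) (W i)

  -- F^p = F : for x ∈ W_i, F^p(x) = G_i(x) must equal F(x)
  FpEqualsF : {F : SetMap n k} → HallPartition F → Set
  FpEqualsF {F} H = ∀ i x → x ∈ W i → G i x ≡ F x
    where open HallPartition H

  Cond3 : SetMap n k → Set
  Cond3 F = Σ (HallPartition F) FpEqualsF

-- By Hall's theorem, y ∈ F(x) lies in the alldifferent kernel as soon as x' ↦ F(x') ∖ {y} satisfies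
-- Hall's condition on X ∖ {x}. This holds when F satisfies Hall's condition and every U ∌ x whose
-- image contains y has surplus ∣U∣ < ∣F(U)∣: a set without surplus is critical, and removing y
-- costs it at most one value. Under (ii) the alldifferent selection gives Hall's condition and a
-- critical U cannot share the value y with the point x ∉ U. Conversely an alldifferent selection s
-- with s(x) = y maps a critical W ∌ x injectively into F(W) ∖ {y}, so y ∉ F(W): this is (i) ⇒ (ii).
--
-- For (ii) ⇒ (iii), repeatedly split off a non-reducible critical subset of what remains; by (ii)
-- the images of the blocks are pairwise disjoint, so G_i = F on W_i. For (iii) ⇒ (i), F^p = F makes
-- every block W_i separated (F(W_i) ∩ F(X ∖ W_i) = ∅) and non-reducible for F. A non-reducible set
-- satisfies Hall's condition, strictly on its nonempty proper subsets, and counting block by block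
-- yields Hall's condition and the surplus property for F.

module Submission where

open import Defs
open import Data.Bool using (Bool; if_then_else_; T)
open import Data.Bool.Properties using (T-≡)
open import Data.Empty using (⊥-elim)
open import Data.Fin using (Fin; toℕ) renaming (zero to fz; suc to fs)
import Data.Fin.Properties as Fin
open import Data.Fin.Subset renaming (⊥ to ∅)
open import Data.Fin.Subset.Induction using (⊂-wellFounded)
open import Data.Fin.Subset.Properties
open import Data.List using (List; map; allFin) renaming ([] to []ₗ; _∷_ to _∷ₗ_)
open import Data.List.Membership.Propositional using () renaming (_∈_ to _∈ₗ_)
open import Data.List.Membership.Propositional.Properties using (∈-allFin)
open import Data.List.Relation.Unary.Any using () renaming (here to hereₗ; there to thereₗ)
open import Data.Nat using (ℕ; suc; _+_; _≤_; _<_; _<ᵇ_; z≤n; s≤s)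
open import Data.Nat.Properties
open import Data.Product using (∃; _×_; _,_; proj₁; proj₂)
open import Data.Sum using (_⊎_; inj₁; inj₂; [_,_]′)
open import Data.Vec using ([]; _∷_; here; there; lookup)
open import Data.Vec.Properties using ([]=⇒lookup; lookup⇒[]=)
open import Function using (_∘_)
open import Function.Bundles using (_⇔_; mk⇔; Equivalence)
open import Induction.WellFounded using (Acc; acc)
open import Relation.Binary.PropositionalEquality
  using (_≡_; _≢_; refl; sym; trans; cong; subst; module ≡-Reasoning)
open import Relation.Nullary using (¬_; Dec; yes; no; does)
open import Relation.Nullary.Decidable using (_×-dec_)
open import Relation.Binary.Definitions using (tri<; tri≈; tri>)

-- Cardinalities and images of subsets

∣p∪q∣+∣p∩q∣≡∣p∣+∣q∣ : ∀ {n} (p q : Subset n) → ∣ p ∪ q ∣ + ∣ p ∩ q ∣ ≡ ∣ p ∣ + ∣ q ∣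
∣p∪q∣+∣p∩q∣≡∣p∣+∣q∣ []            []            = refl
∣p∪q∣+∣p∩q∣≡∣p∣+∣q∣ (inside  ∷ p) (inside  ∷ q) =
  cong suc (trans (+-suc _ _) (trans (cong suc (∣p∪q∣+∣p∩q∣≡∣p∣+∣q∣ p q)) (sym (+-suc _ _))))
∣p∪q∣+∣p∩q∣≡∣p∣+∣q∣ (inside  ∷ p) (outside ∷ q) = cong suc (∣p∪q∣+∣p∩q∣≡∣p∣+∣q∣ p q)
∣p∪q∣+∣p∩q∣≡∣p∣+∣q∣ (outside ∷ p) (inside  ∷ q) =
  trans (cong suc (∣p∪q∣+∣p∩q∣≡∣p∣+∣q∣ p q)) (sym (+-suc _ _))
∣p∪q∣+∣p∩q∣≡∣p∣+∣q∣ (outside ∷ p) (outside ∷ q) = ∣p∪q∣+∣p∩q∣≡∣p∣+∣q∣ p q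

∣p∣≡∣p∩q∣+∣p─q∣ : ∀ {n} (p q : Subset n) → ∣ p ∣ ≡ ∣ p ∩ q ∣ + ∣ p ─ q ∣
∣p∣≡∣p∩q∣+∣p─q∣ []            []            = refl
∣p∣≡∣p∩q∣+∣p─q∣ (inside  ∷ p) (inside  ∷ q) = cong suc (∣p∣≡∣p∩q∣+∣p─q∣ p q)
∣p∣≡∣p∩q∣+∣p─q∣ (inside  ∷ p) (outside ∷ q) = trans (cong suc (∣p∣≡∣p∩q∣+∣p─q∣ p q)) (sym (+-suc _ _))
∣p∣≡∣p∩q∣+∣p─q∣ (outside ∷ p) (inside  ∷ q) = ∣p∣≡∣p∩q∣+∣p─q∣ p q
∣p∣≡∣p∩q∣+∣p─q∣ (outside ∷ p) (outside ∷ q) = ∣p∣≡∣p∩q∣+∣p─q∣ p q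

Empty⇒∣p∣≡0 : ∀ {n} {p : Subset n} → Empty p → ∣ p ∣ ≡ 0
Empty⇒∣p∣≡0 {n} e = trans (cong ∣_∣ (Empty-unique e)) (∣⊥∣≡0 n)

0<∣p∣⇒Nonempty : ∀ {n} {p : Subset n} → 0 < ∣ p ∣ → Nonempty p
0<∣p∣⇒Nonempty {p = p} 0<∣p∣ with nonempty? p
... | yes ne = ne
... | no  e  = ⊥-elim (<-irrefl (sym (Empty⇒∣p∣≡0 e)) 0<∣p∣)

∣p∪q∣≤∣p∣+∣q∣ : ∀ {n} (p q : Subset n) → ∣ p ∪ q ∣ ≤ ∣ p ∣ + ∣ q ∣
∣p∪q∣≤∣p∣+∣q∣ p q = subst (∣ p ∪ q ∣ ≤_) (∣p∪q∣+∣p∩q∣≡∣p∣+∣q∣ p q) (m≤m+n _ _)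

p∩q≡∅⇒∣p∪q∣≡∣p∣+∣q∣ : ∀ {n} (p q : Subset n) → Empty (p ∩ q) → ∣ p ∪ q ∣ ≡ ∣ p ∣ + ∣ q ∣
p∩q≡∅⇒∣p∪q∣≡∣p∣+∣q∣ p q e = begin
  ∣ p ∪ q ∣                ≡⟨ +-identityʳ _ ⟨
  ∣ p ∪ q ∣ + 0            ≡⟨ cong (∣ p ∪ q ∣ +_) (Empty⇒∣p∣≡0 e) ⟨
  ∣ p ∪ q ∣ + ∣ p ∩ q ∣    ≡⟨ ∣p∪q∣+∣p∩q∣≡∣p∣+∣q∣ p q ⟩
  ∣ p ∣ + ∣ q ∣            ∎
  where open ≡-Reasoning

p⊆q∪r⇒∣p∣≤∣q∣+∣r∣ : ∀ {n} {p : Subset n} (q r : Subset n) → p ⊆ q ∪ r → ∣ p ∣ ≤ ∣ q ∣ + ∣ r ∣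
p⊆q∪r⇒∣p∣≤∣q∣+∣r∣ q r p⊆q∪r = ≤-trans (p⊆q⇒∣p∣≤∣q∣ p⊆q∪r) (∣p∪q∣≤∣p∣+∣q∣ q r)

∣p∣≤1+∣p-x∣ : ∀ {n} (p : Subset n) x → ∣ p ∣ ≤ suc ∣ p - x ∣
∣p∣≤1+∣p-x∣ p x = begin
  ∣ p ∣                      ≡⟨ ∣p∣≡∣p∩q∣+∣p─q∣ p ⁅ x ⁆ ⟩
  ∣ p ∩ ⁅ x ⁆ ∣ + ∣ p - x ∣  ≤⟨ +-monoˡ-≤ ∣ p - x ∣ (∣p∩q∣≤∣q∣ p ⁅ x ⁆) ⟩
  ∣ ⁅ x ⁆ ∣ + ∣ p - x ∣      ≡⟨ cong (_+ ∣ p - x ∣) (∣⁅x⁆∣≡1 x) ⟩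
  suc ∣ p - x ∣              ∎
  where open ≤-Reasoning

x∈p⇒0<∣p∣ : ∀ {n} {p : Subset n} {x} → x ∈ p → 0 < ∣ p ∣
x∈p⇒0<∣p∣ x∈p = ≤-trans (s≤s z≤n) (x∈p⇒∣p-x∣<∣p∣ x∈p)

p∩q≡∅⇒p─q≡p : ∀ {n} (p q : Subset n) → Empty (p ∩ q) → p ─ q ≡ p
p∩q≡∅⇒p─q≡p []            []            _  = refl
p∩q≡∅⇒p─q≡p (inside  ∷ p) (inside  ∷ q) e  = ⊥-elim (e (fz , here))
p∩q≡∅⇒p─q≡p (outside ∷ p) (inside  ∷ q) e  = cong (outside ∷_) (p∩q≡∅⇒p─q≡p p q (drop-∷-Empty e))
p∩q≡∅⇒p─q≡p (a       ∷ p) (outside ∷ q) e  = cong (a ∷_) (p∩q≡∅⇒p─q≡p p q (drop-∷-Empty e))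

injectiveOn⇒∣p∣≤∣q∣ : ∀ {n k} (s : Fin n → Fin k) {p : Subset n} {q : Subset k} →
  (∀ {x} → x ∈ p → s x ∈ q) → (∀ {x x'} → x ∈ p → x' ∈ p → s x ≡ s x' → x ≡ x') →
  ∣ p ∣ ≤ ∣ q ∣
injectiveOn⇒∣p∣≤∣q∣ s {[]} into inj = z≤n
injectiveOn⇒∣p∣≤∣q∣ s {outside ∷ p} into inj =
  injectiveOn⇒∣p∣≤∣q∣ (s ∘ fs) (into ∘ there) (λ m m' e → Fin.suc-injective (inj (there m) (there m') e))
injectiveOn⇒∣p∣≤∣q∣ s {inside ∷ p} {q} into inj = ≤-trans (s≤s ∣p∣≤∣q-s0∣) (x∈p⇒∣p-x∣<∣p∣ (into here))
  where
  ∣p∣≤∣q-s0∣ : ∣ p ∣ ≤ ∣ q - s fz ∣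
  ∣p∣≤∣q-s0∣ = injectiveOn⇒∣p∣≤∣q∣ (s ∘ fs)
    (λ m → x∈p∧x≢y⇒x∈p-y (into (there m)) (Fin.0≢1+n ∘ sym ∘ inj (there m) here))
    (λ m m' e → Fin.suc-injective (inj (there m) (there m') e))

x∈p─q⇒x∉q : ∀ {n} {x : Fin n} (p q : Subset n) → x ∈ p ─ q → x ∉ q
x∈p─q⇒x∉q (_ ∷ p) (outside ∷ q) here          = λ ()
x∈p─q⇒x∉q (_ ∷ p) (_       ∷ q) (there x∈p─q) = λ { (there x∈q) → x∈p─q⇒x∉q p q x∈p─q x∈q }

module _ {k : ℕ} {y : Fin k} where

  ∈⋃⁻ : ∀ {A : Set} (h : A → Subset k) (as : List A) → y ∈ ⋃ (map h as) → ∃ λ a → y ∈ h a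
  ∈⋃⁻ h []ₗ       y∈⋃ = ⊥-elim (∉⊥ y∈⋃)
  ∈⋃⁻ h (a ∷ₗ as) y∈⋃ = [ (a ,_) , ∈⋃⁻ h as ]′ (x∈p∪q⁻ (h a) _ y∈⋃)

  ∈⋃⁺ : ∀ {A : Set} {a : A} (h : A → Subset k) (as : List A) → a ∈ₗ as → y ∈ h a → y ∈ ⋃ (map h as)
  ∈⋃⁺ h (_ ∷ₗ as) (hereₗ refl) y∈ha = x∈p∪q⁺ (inj₁ y∈ha)
  ∈⋃⁺ h (_ ∷ₗ as) (thereₗ a∈as) y∈ha = x∈p∪q⁺ (inj₂ (∈⋃⁺ h as a∈as y∈ha))

  ∈if⁻ : ∀ b {p : Subset k} → y ∈ (if b then p else ∅) → T b × y ∈ p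
  ∈if⁻ Bool.true  y∈p = _ , y∈p
  ∈if⁻ Bool.false y∈∅ = ⊥-elim (∉⊥ y∈∅)

  ∈if⁺ : ∀ b {p : Subset k} → T b → y ∈ p → y ∈ (if b then p else ∅)
  ∈if⁺ Bool.true _ y∈p = y∈p

  ∈⋃-guarded⁻ : ∀ {m} (b : Fin m → Bool) (p : Fin m → Subset k) →
    y ∈ ⋃ (map (λ i → if b i then p i else ∅) (allFin m)) → ∃ λ i → T (b i) × y ∈ p i
  ∈⋃-guarded⁻ {m} b p y∈⋃ =
    let i , y∈pᵢ = ∈⋃⁻ (λ i → if b i then p i else ∅) (allFin m) y∈⋃ in i , ∈if⁻ (b i) y∈pᵢ

  ∈⋃-guarded⁺ : ∀ {m} (b : Fin m → Bool) (p : Fin m → Subset k) (i : Fin m) →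
    T (b i) → y ∈ p i → y ∈ ⋃ (map (λ i → if b i then p i else ∅) (allFin m))
  ∈⋃-guarded⁺ {m} b p i bᵢ y∈pᵢ =
    ∈⋃⁺ (λ i → if b i then p i else ∅) (allFin m) (∈-allFin i) (∈if⁺ (b i) bᵢ y∈pᵢ)

module _ {n k : ℕ} (F : SetMap n k) where

  ∈img⁻ : ∀ {W y} → y ∈ img F W → ∃ λ x → x ∈ W × y ∈ F x
  ∈img⁻ {W} y∈FW =
    let x , t , y∈Fx = ∈⋃-guarded⁻ (lookup W) F y∈FW
    in x , lookup⇒[]= x W (Equivalence.to T-≡ t) , y∈Fx

  ∈img⁺ : ∀ {W x y} → x ∈ W → y ∈ F x → y ∈ img F W
  ∈img⁺ {W} {x} x∈W = ∈⋃-guarded⁺ (lookup W) F x (Equivalence.from T-≡ ([]=⇒lookup x∈W))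

  img-mono : ∀ {V W} → V ⊆ W → img F V ⊆ img F W
  img-mono V⊆W y∈FV = let x , x∈V , y∈Fx = ∈img⁻ y∈FV in ∈img⁺ (V⊆W x∈V) y∈Fx

img-cong : ∀ {n k} {F G : SetMap n k} {W : Subset n} → (∀ {x} → x ∈ W → F x ≡ G x) → img F W ≡ img G W
img-cong {F = F} {G} F≗G = ⊆-antisym (transport F≗G) (transport (sym ∘ F≗G))
  where
  transport : ∀ {F G W} → (∀ {x} → x ∈ W → F x ≡ G x) → img F W ⊆ img G W
  transport {F} {G} F≗G y∈FW = let x , x∈W , y∈Fx = ∈img⁻ F y∈FW in ∈img⁺ G x∈W (subst (_ ∈_) (F≗G x∈W) y∈Fx)

module _ {n k m : ℕ} (W : Fin m → Subset n) where

  ∈prefixUnion⁻ : ∀ {i x} → x ∈ prefixUnion {k = k} W i → ∃ λ j → toℕ j < toℕ i × x ∈ W j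
  ∈prefixUnion⁻ {i} x∈P =
    let j , t , x∈Wⱼ = ∈⋃-guarded⁻ (λ j → toℕ j <ᵇ toℕ i) W x∈P in j , <ᵇ⇒< _ _ t , x∈Wⱼ

  ∈prefixUnion⁺ : ∀ {i j x} → toℕ j < toℕ i → x ∈ W j → x ∈ prefixUnion {k = k} W i
  ∈prefixUnion⁺ {i} {j} j<i = ∈⋃-guarded⁺ (λ j → toℕ j <ᵇ toℕ i) W j (<⇒<ᵇ j<i)

-- Hall's theorem

record Matching {n k} (G : SetMap n k) (X : Subset n) (s : Fin n → Fin k) : Set where
  field
    selects   : ∀ {x} → x ∈ X → s x ∈ G x
    injective : ∀ {x x'} → x ∈ X → x' ∈ X → s x ≡ s x' → x ≡ x'

HallCondition : ∀ {n k} → SetMap n k → Subset n → Set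
HallCondition G X = ∀ V → V ⊆ X → ∣ V ∣ ≤ ∣ img G V ∣

_⊖_ : ∀ {n k} → SetMap n k → Fin k → SetMap n k
(G ⊖ y) x = G x - y

_⊕[_]_ : ∀ {n} {A : Set} → (Fin n → A) → Subset n → (Fin n → A) → Fin n → A
(s₁ ⊕[ V ] s₂) x = if does (x ∈? V) then s₁ x else s₂ x

module _ {n k : ℕ} {G : SetMap n k} where

  Matching-⊆ : ∀ {G' X s} → (∀ {x} → G' x ⊆ G x) → Matching G' X s → Matching G X s
  Matching-⊆ G'⊆G M = record { selects = G'⊆G ∘ selects ; injective = injective }
    where open Matching M

  Matching-∅ : ∀ {X} s → Empty X → Matching G X s
  Matching-∅ s X≡∅ = record
    { selects   = λ x∈X → ⊥-elim (X≡∅ (_ , x∈X))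
    ; injective = λ x∈X _ _ → ⊥-elim (X≡∅ (_ , x∈X)) }

  Matching-⁅⁆ : ∀ {x₀ y₀} → y₀ ∈ G x₀ → Matching G ⁅ x₀ ⁆ (λ _ → y₀)
  Matching-⁅⁆ {x₀} y₀∈Gx₀ = record
    { selects   = λ x∈⁅x₀⁆ → subst (λ x → _ ∈ G x) (sym (x∈⁅y⁆⇒x≡y x₀ x∈⁅x₀⁆)) y₀∈Gx₀
    ; injective = λ x∈⁅x₀⁆ x'∈⁅x₀⁆ _ → trans (x∈⁅y⁆⇒x≡y x₀ x∈⁅x₀⁆) (sym (x∈⁅y⁆⇒x≡y x₀ x'∈⁅x₀⁆)) }

  Matching-glue : ∀ {X V s₁ s₂} → Matching G V s₁ → Matching G (X ─ V) s₂ →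
    (∀ {x x'} → x ∈ V → x' ∈ X ─ V → s₁ x ≢ s₂ x') → Matching G X (s₁ ⊕[ V ] s₂)
  Matching-glue {X} {V} {s₁} {s₂} M₁ M₂ apart = record { selects = selects ; injective = injective }
    where
    module M₁ = Matching M₁
    module M₂ = Matching M₂
    selects : ∀ {x} → x ∈ X → (s₁ ⊕[ V ] s₂) x ∈ G x
    selects {x} x∈X with x ∈? V
    ... | yes x∈V = M₁.selects x∈V
    ... | no  x∉V = M₂.selects (x∈p∧x∉q⇒x∈p─q x∈X x∉V)
    injective : ∀ {x x'} → x ∈ X → x' ∈ X → (s₁ ⊕[ V ] s₂) x ≡ (s₁ ⊕[ V ] s₂) x' → x ≡ x'
    injective {x} {x'} x∈X x'∈X eq with x ∈? V | x' ∈? V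
    ... | yes x∈V | yes x'∈V = M₁.injective x∈V x'∈V eq
    ... | yes x∈V | no  x'∉V = ⊥-elim (apart x∈V (x∈p∧x∉q⇒x∈p─q x'∈X x'∉V) eq)
    ... | no  x∉V | yes x'∈V = ⊥-elim (apart x'∈V (x∈p∧x∉q⇒x∈p─q x∈X x∉V) (sym eq))
    ... | no  x∉V | no  x'∉V = M₂.injective (x∈p∧x∉q⇒x∈p─q x∈X x∉V) (x∈p∧x∉q⇒x∈p─q x'∈X x'∉V) eq

⊕-inside : ∀ {n} {A : Set} {s₁ s₂ : Fin n → A} {V x} → x ∈ V → (s₁ ⊕[ V ] s₂) x ≡ s₁ x
⊕-inside {V = V} {x} x∈V with x ∈? V
... | yes _   = refl
... | no  x∉V = ⊥-elim (x∉V x∈V)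

Matching-extend : ∀ {n k} {G : SetMap n k} {X x₀ y₀ s} → y₀ ∈ G x₀ → Matching (G ⊖ y₀) (X - x₀) s →
  Matching G X ((λ _ → y₀) ⊕[ ⁅ x₀ ⁆ ] s)
Matching-extend {G = G} {X} {x₀} {y₀} {s} y₀∈Gx₀ M =
  Matching-glue (Matching-⁅⁆ y₀∈Gx₀) (Matching-⊆ (p─q⊆p _ _) M) y₀≢s
  where
  y₀≢s : ∀ {x x'} → x ∈ ⁅ x₀ ⁆ → x' ∈ X - x₀ → y₀ ≢ s x'
  y₀≢s _ x'∈X-x₀ = x∉⁅y⁆⇒x≢y (x∈p─q⇒x∉q _ _ (Matching.selects M x'∈X-x₀)) ∘ sym

HallCondition-nonempty : ∀ {n k} (G : SetMap n k) {X} →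
  (∀ V → V ⊆ X → Nonempty V → ∣ V ∣ ≤ ∣ img G V ∣) → HallCondition G X
HallCondition-nonempty G hall V V⊆X with nonempty? V
... | yes V≢∅ = hall V V⊆X V≢∅
... | no  V≡∅ = subst (_≤ ∣ img G V ∣) (sym (Empty⇒∣p∣≡0 V≡∅)) z≤n

module _ {n k : ℕ} (G : SetMap n k) where

  img-∪⊆img-restrict∪img : ∀ U V → img G (U ∪ V) ⊆ img (restrict G V) U ∪ img G V
  img-∪⊆img-restrict∪img U V {y} y∈G[U∪V] with ∈img⁻ G {U ∪ V} y∈G[U∪V] | y ∈? img G V
  ... | _                | yes y∈GV = x∈p∪q⁺ (inj₂ y∈GV)
  ... | x , x∈U∪V , y∈Gx | no  y∉GV with x∈p∪q⁻ U V x∈U∪V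
  ...   | inj₁ x∈U = x∈p∪q⁺ (inj₁ (∈img⁺ (restrict G V) x∈U (x∈p∧x∉q⇒x∈p─q y∈Gx y∉GV)))
  ...   | inj₂ x∈V = ⊥-elim (y∉GV (∈img⁺ G x∈V y∈Gx))

  img⊆img-⊖∪⁅⁆ : ∀ U y → img G U ⊆ img (G ⊖ y) U ∪ ⁅ y ⁆
  img⊆img-⊖∪⁅⁆ U y {y'} y'∈GU with y' Fin.≟ y
  ... | yes refl  = x∈p∪q⁺ (inj₂ (x∈⁅x⁆ y))
  ... | no  y'≢y  =
    let x , x∈U , y'∈Gx = ∈img⁻ G {U} y'∈GU in x∈p∪q⁺ (inj₁ (∈img⁺ (G ⊖ y) x∈U (x∈p∧x≢y⇒x∈p-y y'∈Gx y'≢y)))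

  img⊆img-⊖ : ∀ {U y} → y ∉ img G U → img G U ⊆ img (G ⊖ y) U
  img⊆img-⊖ {U} y∉GU y'∈GU =
    let x , x∈U , y'∈Gx = ∈img⁻ G {U} y'∈GU
    in ∈img⁺ (G ⊖ _) x∈U (x∈p∧x≢y⇒x∈p-y y'∈Gx λ { refl → y∉GU y'∈GU })

  <∣img∣⇒≤∣img-⊖∣ : ∀ {U y} → ∣ U ∣ < ∣ img G U ∣ → ∣ U ∣ ≤ ∣ img (G ⊖ y) U ∣
  <∣img∣⇒≤∣img-⊖∣ {U} {y} ∣U∣<∣GU∣ = ≤-pred (begin
    suc ∣ U ∣                        ≤⟨ ∣U∣<∣GU∣ ⟩
    ∣ img G U ∣                      ≤⟨ p⊆q∪r⇒∣p∣≤∣q∣+∣r∣ _ ⁅ y ⁆ (img⊆img-⊖∪⁅⁆ U y) ⟩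
    ∣ img (G ⊖ y) U ∣ + ∣ ⁅ y ⁆ ∣    ≡⟨ cong (∣ img (G ⊖ y) U ∣ +_) (∣⁅x⁆∣≡1 y) ⟩
    ∣ img (G ⊖ y) U ∣ + 1            ≡⟨ +-comm ∣ img (G ⊖ y) U ∣ 1 ⟩
    suc ∣ img (G ⊖ y) U ∣            ∎)
    where open ≤-Reasoning

  HallCondition⇒Nonempty : ∀ {X x} → HallCondition G X → x ∈ X → Nonempty (G x)
  HallCondition⇒Nonempty {X} {x} hall x∈X =
    let y , y∈G⁅x⁆ = 0<∣p∣⇒Nonempty (subst (_≤ ∣ img G ⁅ x ⁆ ∣) (∣⁅x⁆∣≡1 x) (hall ⁅ x ⁆ ⁅x⁆⊆X))
        x' , x'∈⁅x⁆ , y∈Gx' = ∈img⁻ G {⁅ x ⁆} y∈G⁅x⁆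
    in y , subst (λ x → y ∈ G x) (x∈⁅y⁆⇒x≡y x x'∈⁅x⁆) y∈Gx'
    where
    ⁅x⁆⊆X : ⁅ x ⁆ ⊆ X
    ⁅x⁆⊆X x'∈⁅x⁆ = subst (_∈ X) (sym (x∈⁅y⁆⇒x≡y x x'∈⁅x⁆)) x∈X

  ≤∧¬Critical⇒< : ∀ {V} → Nonempty V → ∣ V ∣ ≤ ∣ img G V ∣ → ¬ Critical G V → ∣ V ∣ < ∣ img G V ∣
  ≤∧¬Critical⇒< V≢∅ ∣V∣≤∣GV∣ ¬critical = ≤∧≢⇒< ∣V∣≤∣GV∣ (λ eq → ¬critical (V≢∅ , sym eq))

  HallCondition-restrict : ∀ {X V} → HallCondition G X → V ⊆ X → Critical G V →
    HallCondition (restrict G V) (X ─ V)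
  HallCondition-restrict {X} {V} hall V⊆X (_ , ∣GV∣≡∣V∣) U U⊆X─V = +-cancelʳ-≤ ∣ V ∣ _ _ (begin
    ∣ U ∣ + ∣ V ∣                                ≡⟨ p∩q≡∅⇒∣p∪q∣≡∣p∣+∣q∣ U V U∩V≡∅ ⟨
    ∣ U ∪ V ∣                                    ≤⟨ hall (U ∪ V) U∪V⊆X ⟩
    ∣ img G (U ∪ V) ∣                            ≤⟨ p⊆q∪r⇒∣p∣≤∣q∣+∣r∣ _ _ (img-∪⊆img-restrict∪img U V) ⟩
    ∣ img (restrict G V) U ∣ + ∣ img G V ∣       ≡⟨ cong (∣ img (restrict G V) U ∣ +_) ∣GV∣≡∣V∣ ⟩
    ∣ img (restrict G V) U ∣ + ∣ V ∣             ∎)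
    where
    open ≤-Reasoning
    U∩V≡∅ : Empty (U ∩ V)
    U∩V≡∅ (x , x∈U∩V) = let x∈U , x∈V = x∈p∩q⁻ U V x∈U∩V in x∈p─q⇒x∉q X V (U⊆X─V x∈U) x∈V
    U∪V⊆X : U ∪ V ⊆ X
    U∪V⊆X x∈U∪V = [ p─q⊆p X V ∘ U⊆X─V , V⊆X ]′ (x∈p∪q⁻ U V x∈U∪V)

  HallCondition-⊖ : ∀ {X x₀} y → HallCondition G X → (∀ {U} → U ⊂ X → ¬ Critical G U) → x₀ ∈ X →
    HallCondition (G ⊖ y) (X - x₀)
  HallCondition-⊖ {X} {x₀} y hall noCritical x₀∈X = HallCondition-nonempty (G ⊖ y) λ U U⊆X-x₀ U≢∅ →
    let U⊆X : U ⊆ X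
        U⊆X = p─q⊆p X ⁅ x₀ ⁆ ∘ U⊆X-x₀
        x₀∉U = λ x₀∈U → x∈p─q⇒x∉q X ⁅ x₀ ⁆ (U⊆X-x₀ x₀∈U) (x∈⁅x⁆ x₀)
    in <∣img∣⇒≤∣img-⊖∣ {U} (≤∧¬Critical⇒< U≢∅ (hall U U⊆X) (noCritical (U⊆X , x₀ , x₀∈X , x₀∉U)))

Matching-glue-restrict : ∀ {n k} {G : SetMap n k} {X V s₁ s₂} →
  Matching G V s₁ → Matching (restrict G V) (X ─ V) s₂ → Matching G X (s₁ ⊕[ V ] s₂)
Matching-glue-restrict {G = G} {X} {V} M₁ M₂ =
  Matching-glue M₁ (Matching-⊆ (p─q⊆p _ _) M₂) λ x∈V x'∈X─V s₁x≡s₂x' →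
    x∈p─q⇒x∉q _ (img G V) (Matching.selects M₂ x'∈X─V)
      (subst (_∈ img G V) s₁x≡s₂x' (∈img⁺ G x∈V (Matching.selects M₁ x∈V)))

critical? : ∀ {n k} (G : SetMap n k) V → Dec (Critical G V)
critical? G V = nonempty? V ×-dec (∣ img G V ∣ ≟ ∣ V ∣)

criticalProperSubset? : ∀ {n k} (G : SetMap n k) V → Dec (∃ λ U → U ⊂ V × Critical G U)
criticalProperSubset? G V = anySubset? (λ U → (U ⊂? V) ×-dec critical? G U)

-- The Halmos–Vaughan induction: split along a critical proper subset if there is one, otherwise
-- any choice x₀ ↦ y₀ keeps Hall's condition on the rest. Only the values of a matching on X
-- matter; the default value of type Fin k fills in the rest.
HallCondition⇒Matching : ∀ {n k} (G : SetMap n k) {X} → HallCondition G X → Fin k → ∃ (Matching G X)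
HallCondition⇒Matching {n} G {X} hallG default = go G (⊂-wellFounded X) hallG
  where
  go : ∀ G {X : Subset n} → Acc _⊂_ X → HallCondition G X → ∃ (Matching G X)
  go G {X} (acc smaller) hallG with criticalProperSubset? G X
  ... | yes (V , V⊂X@(V⊆X , _) , critical@((x , x∈V) , _)) =
    let s₁ , M₁ = go G (smaller V⊂X) (λ U U⊆V → hallG U (⊆-trans U⊆V V⊆X))
        s₂ , M₂ = go (restrict G V) (smaller (p∩q≢∅⇒p─q⊂p X V (x , x∈p∩q⁺ (V⊆X x∈V , x∈V))))
                    (HallCondition-restrict G hallG V⊆X critical)
    in s₁ ⊕[ V ] s₂ , Matching-glue-restrict M₁ M₂
  ... | no noCritical with nonempty? X
  ...   | no  X≡∅          = (λ _ → default) , Matching-∅ _ X≡∅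
  ...   | yes (x₀ , x₀∈X) =
    let y₀ , y₀∈Gx₀ = HallCondition⇒Nonempty G hallG x₀∈X
        s , M = go (G ⊖ y₀) (smaller (x∈p⇒p-x⊂p x₀∈X))
                  (HallCondition-⊖ G y₀ hallG (λ U⊂X critical → noCritical (_ , U⊂X , critical)) x₀∈X)
    in _ , Matching-extend y₀∈Gx₀ M

-- The alldifferent kernel and condition (ii)

module _ {n k : ℕ} (F : SetMap n k) where

  Matching⇒IsAllDiffSelection : ∀ {s} → Matching F ⊤ s → IsAllDiffSelection F s
  Matching⇒IsAllDiffSelection M = (λ x → selects ∈⊤) , injective ∈⊤ ∈⊤
    where open Matching M

  IsAllDiffSelection⇒Matching : ∀ {X s} → IsAllDiffSelection F s → Matching F X s
  IsAllDiffSelection⇒Matching (selection , injective) =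
    record { selects = λ {x} _ → selection x ; injective = λ _ _ → injective }

  Matching⇒HallCondition : ∀ {X s} → Matching F X s → HallCondition F X
  Matching⇒HallCondition {s = s} M U U⊆X =
    injectiveOn⇒∣p∣≤∣q∣ s (λ x∈U → ∈img⁺ F x∈U (selects (U⊆X x∈U)))
      (λ x∈U x'∈U → injective (U⊆X x∈U) (U⊆X x'∈U))
    where open Matching M

  HallCondition-⊖⇒∈Kernel : ∀ {x y} → y ∈ F x → HallCondition (F ⊖ y) (⊤ - x) → y ∈Kernel F at x
  HallCondition-⊖⇒∈Kernel {x} {y} y∈Fx hall⊖ =
    let s , M = HallCondition⇒Matching (F ⊖ y) hall⊖ y
    in y∈Fx , (λ _ → y) ⊕[ ⁅ x ⁆ ] s , Matching⇒IsAllDiffSelection (Matching-extend y∈Fx M) ,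
       ⊕-inside {s₂ = s} (x∈⁅x⁆ x)

  SharedValueSurplus : Set
  SharedValueSurplus = ∀ {U x y} → x ∉ U → y ∈ F x → y ∈ img F U → ∣ U ∣ < ∣ img F U ∣

  Hall∧SharedValueSurplus⇒IsAllDifferent : HallCondition F ⊤ → SharedValueSurplus → IsAllDifferent F
  Hall∧SharedValueSurplus⇒IsAllDifferent hallF surplus =
    (λ x → HallCondition⇒Nonempty F hallF ∈⊤) ,
    λ x y → proj₁ , λ y∈Fx → HallCondition-⊖⇒∈Kernel y∈Fx (hall⊖ y∈Fx)
    where
    hall⊖ : ∀ {x y} → y ∈ F x → HallCondition (F ⊖ y) (⊤ - x)
    hall⊖ {x} {y} y∈Fx U U⊆⊤-x with y ∈? img F U
    ... | yes y∈FU = <∣img∣⇒≤∣img-⊖∣ F {U} (surplus x∉U y∈Fx y∈FU)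
      where
      x∉U : x ∉ U
      x∉U x∈U = x∈p─q⇒x∉q ⊤ ⁅ x ⁆ (U⊆⊤-x x∈U) (x∈⁅x⁆ x)
    ... | no  y∉FU = ≤-trans (hallF U ⊆⊤) (p⊆q⇒∣p∣≤∣q∣ (img⊆img-⊖ F {U} y∉FU))

  IsAllDiffSelection⇒surplus : ∀ {s W x} → IsAllDiffSelection F s → x ∉ W → s x ∈ img F W → ∣ W ∣ < ∣ img F W ∣
  IsAllDiffSelection⇒surplus {s} {W} {x} (selection , injective) x∉W sx∈FW = begin-strict
    ∣ W ∣              ≤⟨ injectiveOn⇒∣p∣≤∣q∣ s sW⊆FW-sx (λ _ _ → injective) ⟩
    ∣ img F W - s x ∣  <⟨ x∈p⇒∣p-x∣<∣p∣ sx∈FW ⟩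
    ∣ img F W ∣        ∎
    where
    open ≤-Reasoning
    sW⊆FW-sx : ∀ {w} → w ∈ W → s w ∈ img F W - s x
    sW⊆FW-sx w∈W = x∈p∧x≢y⇒x∈p-y (∈img⁺ F w∈W (selection _)) (λ eq → x∉W (subst (_∈ W) (injective eq) w∈W))

Separated : ∀ {n k} → SetMap n k → Subset n → Set
Separated F W = Empty (img F W ∩ img F (∁ W))

IsAllDifferent⇒Cond2 : ∀ {n k} (F : SetMap (suc n) k) → IsAllDifferent F → Cond2 F
IsAllDifferent⇒Cond2 F (nonempty , kernel) = selection , separated
  where
  selection : HasAllDiffSelection F
  selection =
    let y , y∈F0 = nonempty fz
        _ , s , isSelection , _ = proj₂ (kernel fz y) y∈F0
    in s , isSelection
  separated : ∀ W → Critical F W → Separated F W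
  separated W (_ , ∣FW∣≡∣W∣) (y , y∈FW∩F∁W) =
    let y∈FW , y∈F∁W = x∈p∩q⁻ (img F W) (img F (∁ W)) y∈FW∩F∁W
        x , x∈∁W , y∈Fx = ∈img⁻ F {∁ W} y∈F∁W
        _ , s , isSelection , sx≡y = proj₂ (kernel x y) y∈Fx
        surplus = IsAllDiffSelection⇒surplus F isSelection (x∈∁p⇒x∉p x∈∁W) (subst (_∈ img F W) (sym sx≡y) y∈FW)
    in <⇒≢ surplus (sym ∣FW∣≡∣W∣)

Cond2⇒IsAllDifferent : ∀ {n k} (F : SetMap n k) → Cond2 F → IsAllDifferent F
Cond2⇒IsAllDifferent F ((s , isSelection) , separated) = Hall∧SharedValueSurplus⇒IsAllDifferent F hallF surplus
  where
  hallF : HallCondition F ⊤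
  hallF = Matching⇒HallCondition F (IsAllDiffSelection⇒Matching F isSelection)
  surplus : SharedValueSurplus F
  surplus {U} x∉U y∈Fx y∈FU =
    let x' , x'∈U , _ = ∈img⁻ F {U} y∈FU
    in ≤∧¬Critical⇒< F (x' , x'∈U) (hallF U ⊆⊤) λ critical →
         separated U critical (_ , x∈p∩q⁺ (y∈FU , ∈img⁺ F (x∉p⇒x∈∁p x∉U) y∈Fx))

-- Hall partitions

module _ {n k : ℕ} where

  Critical-agree : ∀ {F G : SetMap n k} {W} → (∀ {x} → x ∈ W → F x ≡ G x) → ∀ {V} → V ⊆ W →
    Critical F V → Critical G V
  Critical-agree {F} {G} agree V⊆W (V≢∅ , ∣FV∣≡∣V∣) =
    V≢∅ , trans (cong ∣_∣ (img-cong {F = G} {F} (λ x∈V → sym (agree (V⊆W x∈V))))) ∣FV∣≡∣V∣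

  NonReducible-agree : ∀ {F G : SetMap n k} {W} → (∀ {x} → x ∈ W → F x ≡ G x) →
    NonReducible F W → NonReducible G W
  NonReducible-agree {F} {G} agree (W≢∅ , irreducible) =
    W≢∅ , λ U U⊂W critical →
      irreducible U U⊂W (Critical-agree {F = G} {F} (λ x∈W → sym (agree x∈W)) (proj₁ U⊂W) critical)

module _ {n k : ℕ} (F : SetMap n k) where

  separated-split : ∀ {W} U → Separated F W → ∣ img F (U ∩ W) ∣ + ∣ img F (U ─ W) ∣ ≤ ∣ img F U ∣
  separated-split {W} U separated = begin
    ∣ img F (U ∩ W) ∣ + ∣ img F (U ─ W) ∣   ≡⟨ p∩q≡∅⇒∣p∪q∣≡∣p∣+∣q∣ _ _ disjoint ⟨
    ∣ img F (U ∩ W) ∪ img F (U ─ W) ∣       ≤⟨ p⊆q⇒∣p∣≤∣q∣ ∪⊆FU ⟩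
    ∣ img F U ∣                             ∎
    where
    open ≤-Reasoning
    U─W⊆∁W : U ─ W ⊆ ∁ W
    U─W⊆∁W x∈U─W = x∉p⇒x∈∁p (x∈p─q⇒x∉q U W x∈U─W)
    disjoint : Empty (img F (U ∩ W) ∩ img F (U ─ W))
    disjoint (y , y∈both) =
      let y∈F[U∩W] , y∈F[U─W] = x∈p∩q⁻ _ _ y∈both
      in separated (y , x∈p∩q⁺ (img-mono F (p∩q⊆q U W) y∈F[U∩W] , img-mono F U─W⊆∁W y∈F[U─W]))
    ∪⊆FU : img F (U ∩ W) ∪ img F (U ─ W) ⊆ img F U
    ∪⊆FU y∈∪ = [ img-mono F (p∩q⊆p U W) , img-mono F (p─q⊆p U W) ]′ (x∈p∪q⁻ _ _ y∈∪)

  nonReducible⇒HallCondition : ∀ {W} → NonReducible F W → (∀ {x} → x ∈ W → Nonempty (F x)) →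
    HallCondition F W
  nonReducible⇒HallCondition {W} (_ , irreducible) nonempty =
    HallCondition-nonempty F λ V V⊆W V≢∅ → go (⊂-wellFounded V) V⊆W V≢∅
    where
    open ≤-Reasoning
    go : ∀ {V} → Acc _⊂_ V → V ⊆ W → Nonempty V → ∣ V ∣ ≤ ∣ img F V ∣
    go {V} (acc smaller) V⊆W (x , x∈V) with nonempty? (V - x)
    ... | no  V-x≡∅ = begin
      ∣ V ∣          ≤⟨ ∣p∣≤1+∣p-x∣ V x ⟩
      suc ∣ V - x ∣  ≡⟨ cong suc (Empty⇒∣p∣≡0 V-x≡∅) ⟩
      1              ≤⟨ x∈p⇒0<∣p∣ (∈img⁺ F x∈V (proj₂ (nonempty (V⊆W x∈V)))) ⟩
      ∣ img F V ∣    ∎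
    ... | yes V-x≢∅ = begin
      ∣ V ∣                ≤⟨ ∣p∣≤1+∣p-x∣ V x ⟩
      suc ∣ V - x ∣        ≤⟨ ≤∧¬Critical⇒< F V-x≢∅ (go (smaller (x∈p⇒p-x⊂p x∈V)) V-x⊆W V-x≢∅)
                                (irreducible (V - x) V-x⊂W) ⟩
      ∣ img F (V - x) ∣    ≤⟨ p⊆q⇒∣p∣≤∣q∣ (img-mono F (p─q⊆p V ⁅ x ⁆)) ⟩
      ∣ img F V ∣          ∎
      where
      V-x⊆W : V - x ⊆ W
      V-x⊆W = V⊆W ∘ p─q⊆p V ⁅ x ⁆
      V-x⊂W : V - x ⊂ W
      V-x⊂W = V-x⊆W , x , V⊆W x∈V , λ x∈V-x → x∈p─q⇒x∉q V ⁅ x ⁆ x∈V-x (x∈⁅x⁆ x)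

  cover⇒HallCondition : (∀ x → ∃ λ W → x ∈ W × Separated F W × HallCondition F W) → HallCondition F ⊤
  cover⇒HallCondition cover V _ = go (⊂-wellFounded V)
    where
    go : ∀ {V} → Acc _⊂_ V → ∣ V ∣ ≤ ∣ img F V ∣
    go {V} (acc smaller) with nonempty? V
    ... | no  V≡∅         = subst (_≤ ∣ img F V ∣) (sym (Empty⇒∣p∣≡0 V≡∅)) z≤n
    ... | yes (x , x∈V) with cover x
    ...   | W , x∈W , separated , hallW = begin
      ∣ V ∣                                   ≡⟨ ∣p∣≡∣p∩q∣+∣p─q∣ V W ⟩
      ∣ V ∩ W ∣ + ∣ V ─ W ∣                   ≤⟨ +-mono-≤ (hallW (V ∩ W) (p∩q⊆q V W)) (go (smaller V─W⊂V)) ⟩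
      ∣ img F (V ∩ W) ∣ + ∣ img F (V ─ W) ∣   ≤⟨ separated-split V separated ⟩
      ∣ img F V ∣                             ∎
      where
      open ≤-Reasoning
      V─W⊂V : V ─ W ⊂ V
      V─W⊂V = p∩q≢∅⇒p─q⊂p V W (x , x∈p∩q⁺ (x∈V , x∈W))

  cover⇒SharedValueSurplus : HallCondition F ⊤ →
    (∀ x → ∃ λ W → x ∈ W × Separated F W × NonReducible F W) → SharedValueSurplus F
  cover⇒SharedValueSurplus hallF cover {U} {x} {y} x∉U y∈Fx y∈FU with cover x | ∈img⁻ F {U} y∈FU
  ... | W , x∈W , separated , (_ , irreducible) | x' , x'∈U , y∈Fx' = begin-strict
    ∣ U ∣                                   ≡⟨ ∣p∣≡∣p∩q∣+∣p─q∣ U W ⟩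
    ∣ U ∩ W ∣ + ∣ U ─ W ∣                   <⟨ +-mono-<-≤ surplus (hallF (U ─ W) ⊆⊤) ⟩
    ∣ img F (U ∩ W) ∣ + ∣ img F (U ─ W) ∣   ≤⟨ separated-split U separated ⟩
    ∣ img F U ∣                             ∎
    where
    open ≤-Reasoning
    x'∈W : x' ∈ W
    x'∈W with x' ∈? W
    ... | yes x'∈W = x'∈W
    ... | no  x'∉W = ⊥-elim (separated (y , x∈p∩q⁺ (∈img⁺ F x∈W y∈Fx , ∈img⁺ F (x∉p⇒x∈∁p x'∉W) y∈Fx')))
    U∩W⊂W : U ∩ W ⊂ W
    U∩W⊂W = p∩q⊆q U W , x , x∈W , x∉U ∘ proj₁ ∘ x∈p∩q⁻ U W
    surplus : ∣ U ∩ W ∣ < ∣ img F (U ∩ W) ∣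
    surplus = ≤∧¬Critical⇒< F (x' , x∈p∩q⁺ (x'∈U , x'∈W)) (hallF (U ∩ W) ⊆⊤) (irreducible (U ∩ W) U∩W⊂W)

module _ {n k : ℕ} {F : SetMap n k} (H : HallPartition F) (Fp≡F : FpEqualsF H) where
  open HallPartition H

  earlier-blocks-avoid-values : ∀ {i j x x' y} → toℕ j < toℕ i → x ∈ W i → x' ∈ W j → y ∈ F x → y ∉ F x'
  earlier-blocks-avoid-values {i} {j} {x} j<i x∈Wᵢ x'∈Wⱼ y∈Fx y∈Fx' =
    x∈p─q⇒x∉q (F x) (img F (prefixUnion {k = k} W i)) (subst (_ ∈_) (sym (Fp≡F i x x∈Wᵢ)) y∈Fx)
      (∈img⁺ F (∈prefixUnion⁺ {k = k} W j<i x'∈Wⱼ) y∈Fx')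

  distinct-blocks-avoid-values : ∀ {i j x x' y} → i ≢ j → x ∈ W i → x' ∈ W j → y ∈ F x → y ∉ F x'
  distinct-blocks-avoid-values {i} {j} i≢j x∈Wᵢ x'∈Wⱼ y∈Fx with <-cmp (toℕ i) (toℕ j)
  ... | tri< i<j _ _ = λ y∈Fx' → earlier-blocks-avoid-values i<j x'∈Wⱼ x∈Wᵢ y∈Fx' y∈Fx
  ... | tri≈ _ i≡j _ = ⊥-elim (i≢j (Fin.toℕ-injective i≡j))
  ... | tri> _ _ j<i = earlier-blocks-avoid-values j<i x∈Wᵢ x'∈Wⱼ y∈Fx

  block-separated : ∀ i → Separated F (W i)
  block-separated i (y , y∈both) =
    let y∈FWᵢ , y∈F∁Wᵢ     = x∈p∩q⁻ (img F (W i)) _ y∈both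
        x , x∈Wᵢ , y∈Fx     = ∈img⁻ F {W i} y∈FWᵢ
        x' , x'∈∁Wᵢ , y∈Fx' = ∈img⁻ F {∁ (W i)} y∈F∁Wᵢ
        j , x'∈Wⱼ           = covers x'
        i≢j : i ≢ j
        i≢j i≡j = x∈∁p⇒x∉p x'∈∁Wᵢ (subst (λ t → x' ∈ W t) (sym i≡j) x'∈Wⱼ)
    in distinct-blocks-avoid-values i≢j x∈Wᵢ x'∈Wⱼ y∈Fx y∈Fx'

  block-nonReducible : ∀ i → NonReducible F (W i)
  block-nonReducible i = NonReducible-agree (λ {x} x∈Wᵢ → Fp≡F i x x∈Wᵢ) (cond-ii i)

  HallPartition-values-nonempty : ∀ x → Nonempty (F x)
  HallPartition-values-nonempty x = let i , x∈Wᵢ = covers x in subst Nonempty (Fp≡F i x x∈Wᵢ) (cond-i i x x∈Wᵢ)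

  HallPartition⇒cover : ∀ x → ∃ λ W → x ∈ W × Separated F W × NonReducible F W
  HallPartition⇒cover x = let i , x∈Wᵢ = covers x in W i , x∈Wᵢ , block-separated i , block-nonReducible i

Cond3⇒IsAllDifferent : ∀ {n k} (F : SetMap n k) → Cond3 F → IsAllDifferent F
Cond3⇒IsAllDifferent F (H , Fp≡F) =
  Hall∧SharedValueSurplus⇒IsAllDifferent F hallF (cover⇒SharedValueSurplus F hallF cover)
  where
  cover = HallPartition⇒cover H Fp≡F
  hallF : HallCondition F ⊤
  hallF = cover⇒HallCondition F λ x →
    let W , x∈W , separated , nonReducible = cover x
    in W , x∈W , separated ,
       nonReducible⇒HallCondition F nonReducible (λ {x} _ → HallPartition-values-nonempty H Fp≡F x)

module _ {n k : ℕ} (F : SetMap n k) where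

  nonReducible-⊆ : ∀ {V} → Nonempty V → ∃ λ V' → V' ⊆ V × NonReducible F V' × (V' ≡ V ⊎ Critical F V')
  nonReducible-⊆ {V} = go (⊂-wellFounded V)
    where
    go : ∀ {V} → Acc _⊂_ V → Nonempty V → ∃ λ V' → V' ⊆ V × NonReducible F V' × (V' ≡ V ⊎ Critical F V')
    go {V} (acc smaller) V≢∅ with criticalProperSubset? F V
    ... | no  noCritical = V , ⊆-refl , (V≢∅ , λ U U⊂V critical → noCritical (U , U⊂V , critical)) , inj₁ refl
    ... | yes (U , U⊂V@(U⊆V , _) , critical@(U≢∅ , _)) =
      let V' , V'⊆U , nonReducible , V'≡U⊎critical = go (smaller U⊂V) U≢∅
          criticalV' = [ (λ V'≡U → subst (Critical F) (sym V'≡U) critical) , (λ c → c) ]′ V'≡U⊎critical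
      in V' , ⊆-trans V'⊆U U⊆V , nonReducible , inj₂ criticalV'

  record NonReducibleDecomposition (R : Subset n) : Set where
    field
      m            : ℕ
      W            : Fin (suc m) → Subset n
      within       : ∀ i → W i ⊆ R
      disjoint     : ∀ i j → i ≢ j → Empty (W i ∩ W j)
      covers       : ∀ {x} → x ∈ R → ∃ λ i → x ∈ W i
      nonReducible : ∀ i → NonReducible F (W i)
      critical     : ∀ i → toℕ i < m → Critical F (W i)

  single-block : ∀ {R V} → V ⊆ R → R ⊆ V → NonReducible F V → NonReducibleDecomposition R
  single-block {V = V} V⊆R R⊆V nonReducible = record
    { m = 0 ; W = λ _ → V ; within = λ _ → V⊆R
    ; disjoint = λ { fz fz fz≢fz → ⊥-elim (fz≢fz refl) }
    ; covers = λ x∈R → fz , R⊆V x∈R ; nonReducible = λ _ → nonReducible ; critical = λ { fz () } }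

  cons-block : ∀ {R V} → V ⊆ R → NonReducible F V → Critical F V → NonReducibleDecomposition (R ─ V) →
    NonReducibleDecomposition R
  cons-block {R} {V} V⊆R nonReducibleV criticalV D = record
    { m = suc D.m ; W = W ; within = within ; disjoint = disjoint ; covers = covers
    ; nonReducible = nonReducible ; critical = critical }
    where
    module D = NonReducibleDecomposition D
    W : Fin (suc (suc D.m)) → Subset n
    W fz     = V
    W (fs i) = D.W i
    within : ∀ i → W i ⊆ R
    within fz     = V⊆R
    within (fs i) = p─q⊆p R V ∘ D.within i
    outsideV : ∀ i {x} → x ∈ D.W i → x ∉ V
    outsideV i x∈Wᵢ = x∈p─q⇒x∉q R V (D.within i x∈Wᵢ)
    disjoint : ∀ i j → i ≢ j → Empty (W i ∩ W j)
    disjoint fz     fz     i≢j _             = i≢j refl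
    disjoint fz     (fs j) _   (x , x∈V∩Wⱼ) = let x∈V , x∈Wⱼ = x∈p∩q⁻ V (D.W j) x∈V∩Wⱼ in outsideV j x∈Wⱼ x∈V
    disjoint (fs i) fz     _   (x , x∈Wᵢ∩V) = let x∈Wᵢ , x∈V = x∈p∩q⁻ (D.W i) V x∈Wᵢ∩V in outsideV i x∈Wᵢ x∈V
    disjoint (fs i) (fs j) i≢j = D.disjoint i j (i≢j ∘ cong fs)
    covers : ∀ {x} → x ∈ R → ∃ λ i → x ∈ W i
    covers {x} x∈R with x ∈? V
    ... | yes x∈V = fz , x∈V
    ... | no  x∉V = let i , x∈Wᵢ = D.covers (x∈p∧x∉q⇒x∈p─q x∈R x∉V) in fs i , x∈Wᵢ
    nonReducible : ∀ i → NonReducible F (W i)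
    nonReducible fz     = nonReducibleV
    nonReducible (fs i) = D.nonReducible i
    critical : ∀ i → toℕ i < suc D.m → Critical F (W i)
    critical fz     _   = criticalV
    critical (fs i) i<m = D.critical i (≤-pred i<m)

  decompose : ∀ {R} → Nonempty R → NonReducibleDecomposition R
  decompose {R} = go (⊂-wellFounded R)
    where
    go : ∀ {R} → Acc _⊂_ R → Nonempty R → NonReducibleDecomposition R
    go {R} (acc smaller) R≢∅ with nonReducible-⊆ R≢∅
    ... | V , V⊆R , nonReducibleV , V≡R⊎criticalV with nonempty? (R ─ V)
    ...   | no  R─V≡∅ = single-block V⊆R R⊆V nonReducibleV
      where
      R⊆V : R ⊆ V
      R⊆V {x} x∈R with x ∈? V
      ... | yes x∈V = x∈V
      ... | no  x∉V = ⊥-elim (R─V≡∅ (x , x∈p∧x∉q⇒x∈p─q x∈R x∉V))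
    ...   | yes (x , x∈R─V) =
      cons-block V⊆R nonReducibleV criticalV (go (smaller (p∩q≢∅⇒p─q⊂p R V R∩V≢∅)) (x , x∈R─V))
      where
      criticalV : Critical F V
      criticalV = [ (λ { refl → ⊥-elim (x∈p─q⇒x∉q R R x∈R─V (p─q⊆p R R x∈R─V)) }) , (λ c → c) ]′ V≡R⊎criticalV
      R∩V≢∅ : Nonempty (R ∩ V)
      R∩V≢∅ = let y , y∈V = proj₁ nonReducibleV in y , x∈p∩q⁺ (V⊆R y∈V , y∈V)

Cond2⇒Cond3 : ∀ {n k} (F : SetMap (suc n) k) → Cond2 F → Cond3 F
Cond2⇒Cond3 {k = k} F ((s , selection , _) , separated) = H , λ i x → agree i
  where
  open NonReducibleDecomposition (decompose F {⊤} (fz , ∈⊤))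
  agree : ∀ i {x} → x ∈ W i → restrict F (prefixUnion {k = k} W i) x ≡ F x
  agree i {x} x∈Wᵢ = p∩q≡∅⇒p─q≡p (F x) _ λ (y , y∈both) →
    let y∈Fx , y∈FP = x∈p∩q⁻ (F x) _ y∈both
        x' , x'∈P , y∈Fx' = ∈img⁻ F {prefixUnion {k = k} W i} y∈FP
        j , j<i , x'∈Wⱼ = ∈prefixUnion⁻ {k = k} W x'∈P
        x∉Wⱼ : x ∉ W j
        x∉Wⱼ x∈Wⱼ = disjoint i j (λ i≡j → <-irrefl (cong toℕ (sym i≡j)) j<i) (x , x∈p∩q⁺ (x∈Wᵢ , x∈Wⱼ))
    in separated (W j) (critical j (<-≤-trans j<i (≤-pred (Fin.toℕ<n i))))
         (y , x∈p∩q⁺ (∈img⁺ F x'∈Wⱼ y∈Fx' , ∈img⁺ F (x∉p⇒x∈∁p x∉Wⱼ) y∈Fx))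
  H : HallPartition F
  H = record
    { m = m ; W = W ; nonempty = proj₁ ∘ nonReducible ; disjoint = disjoint ; covers = λ x → covers ∈⊤
    ; cond-i   = λ i x x∈Wᵢ → subst Nonempty (sym (agree i x∈Wᵢ)) (s x , selection x)
    ; cond-ii  = λ i → NonReducible-agree (λ x∈Wᵢ → sym (agree i x∈Wᵢ)) (nonReducible i)
    ; cond-iii = λ i i<m → Critical-agree (λ x∈Wᵢ → sym (agree i x∈Wᵢ)) ⊆-refl (critical i i<m) }

theorem5p1 : (n k : ℕ) (F : Fin (suc n) → Subset (suc k)) →
    (IsAllDifferent F ⇔ Cond2 F) × (Cond2 F ⇔ Cond3 F)
theorem5p1 n k F =
  mk⇔ (IsAllDifferent⇒Cond2 F) (Cond2⇒IsAllDifferent F) ,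
  mk⇔ (Cond2⇒Cond3 F) (IsAllDifferent⇒Cond2 F ∘ Cond3⇒IsAllDifferent F)
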